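{- If there is an RTLW($k$) refutation of a set $F$ of clauses of size $s$, then there is an RTLW($k$) refutation of $F$ of size at most $2s$ in which no clause $C$ with $C\supseteq D$ for some clause $D\in F$ is used as a lemma.
   Context: Clauses are finite sets of literals; $\Box$ the empty clause. Resolution: from $C_0\ni x$, $C_1\ni\overline x$ infer $(C_0\setminus\{x\})\cup(C_1\setminus\{\overline x\})$; weakening: from $C$ infer any $C'\supseteq C$. An RTLW refutation of $F$ is an ordered tree $T$ with post-order $<_T$ (for each node, its left subtree before its right subtree before the node itself) in which each node has $0$, $1$ or $2$ children; each leaf $v$ is labeled by a clause of $F$ or by a clause labeling some node $u<_T v$ (such a leaf is a lemma, i.e. the clause is used as a lemma); each node with two children is labeled by the resolvent (on some variable) of its children's clauses; each node with one child is labeled by a weakening of its child's clause; the root is labeled $\Box$. Size = number of nodes. RTLW($k$) is RTLW restricted so that every lemma (leaf label not occurring in $F$) has at most $k$ literals. -}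

module Defs where

open import Data.Nat using (ℕ; _≤_; _*_)
open import Data.Bool using (Bool; true; false; not)
import Data.Bool as Bool
import Data.Nat as Nat
open import Data.Product using (_×_; _,_; Σ; ∃-syntax)
open import Data.Product.Properties using (≡-dec)
open import Data.Sum using (_⊎_)
open import Data.Unit using (⊤)
open import Data.List using (List; []; _∷_; _++_; [_]; length; deduplicate)
open import Data.List.Membership.Propositional using (_∈_; _∉_)
open import Data.List.Relation.Binary.Subset.Propositional using (_⊆_)
open import Data.List.Relation.Unary.Any using (Any)
open import Relation.Binary.PropositionalEquality using (_≡_; _≢_)
open import Relation.Binary.Definitions using (DecidableEquality)
open import Relation.Nullary using (¬_)

-- A literal is a variable (a natural number) with a polarity
-- (true = positive literal x, false = negated literal x̄).
Lit : Set
Lit = ℕ × Bool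

_≟ₗ_ : DecidableEquality Lit
_≟ₗ_ = ≡-dec Nat._≟_ Bool._≟_

neg : Lit → Lit
neg (v , b) = (v , not b)

-- A clause is a finite set of literals, represented by a list;
-- only membership matters (duplicates and order are irrelevant).
Clause : Set
Clause = List Lit

_≋_ : Clause → Clause → Set
C ≋ D = (C ⊆ D) × (D ⊆ C)

card : Clause → ℕ
card C = length (deduplicate _≟ₗ_ C)

InF : List Clause → Clause → Set
InF F C = Any (λ D → D ≋ C) F

IsResolvent : Clause → Clause → Clause → Set
IsResolvent C0 C1 C =
  Σ Lit λ x → (x ∈ C0) × (neg x ∈ C1) ×
    (∀ y → ((y ∈ C → ((y ∈ C0 × y ≢ x) ⊎ (y ∈ C1 × y ≢ neg x)))
          × (((y ∈ C0 × y ≢ x) ⊎ (y ∈ C1 × y ≢ neg x)) → y ∈ C)))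

data Tree : Set where
  leaf : Clause → Tree
  weak : Clause → Tree → Tree
  res  : Clause → Tree → Tree → Tree

label : Tree → Clause
label (leaf C)    = C
label (weak C _)  = C
label (res C _ _) = C

postorder : Tree → List (Bool × Clause)
postorder (leaf C)    = [ (true , C) ]
postorder (weak C t)  = postorder t ++ [ (false , C) ]
postorder (res C l r) = postorder l ++ postorder r ++ [ (false , C) ]

size : Tree → ℕ
size T = length (postorder T)

Local : Tree → Set
Local (leaf C)    = ⊤
Local (weak C t)  = (label t ⊆ C) × Local t
Local (res C l r) = IsResolvent (label l) (label r) C × Local l × Local r

-- leaf condition: every leaf is labeled by a clause of F or by the label of
-- some node earlier in post-order.  `prev` = labels of the nodes seen so far.
LeavesOK : List Clause → List Clause → List (Bool × Clause) → Set
LeavesOK F prev []                  = ⊤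
LeavesOK F prev ((true  , C) ∷ ns)  =
  (InF F C ⊎ Any (λ D → D ≋ C) prev) × LeavesOK F (prev ++ [ C ]) ns
LeavesOK F prev ((false , C) ∷ ns)  = LeavesOK F (prev ++ [ C ]) ns

RTLW : List Clause → Tree → Set
RTLW F T = Local T × LeavesOK F [] (postorder T) × (label T ≡ [])

AllLemmas : (Clause → Set) → List Clause → Tree → Set
AllLemmas P F T = ∀ C → (true , C) ∈ postorder T → ¬ InF F C → P C

RTLWk : ℕ → List Clause → Tree → Set
RTLWk k F T = RTLW F T × AllLemmas (λ C → card C ≤ k) F T

NoSubsumedLemma : List Clause → Tree → Set
NoSubsumedLemma F T = AllLemmas (λ C → ¬ Any (λ D → D ⊆ C) F) F T

-- Replace every leaf C that contains some clause D of F by the weakening step D ⊢ C, with D an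
-- axiom leaf. The leaf conditions survive because axioms need no earlier node and the
-- earlier-node labels only grow; every leaf of the new tree is an axiom or an old lemma leaf
-- containing no clause of F; and each node becomes at most two nodes.
module Submission where

open import Defs
open import Data.Nat using (ℕ; _≤_; _*_; _+_; z≤n; s≤s)
open import Data.Nat.Properties using (+-mono-≤; *-suc; ≤-reflexive; ≤-trans; module ≤-Reasoning)
open import Data.Bool using (Bool; true; false)
open import Data.List using (List; []; _∷_; _++_; [_]; length; concatMap)
open import Data.List.Properties using (length-++; concatMap-++; ++-identityʳ)
open import Data.Product using (_×_; ∃-syntax; _,_; proj₁; proj₂)
open import Data.Sum using (_⊎_; inj₁; inj₂)
import Data.Sum as Sum
open import Data.Unit using (tt)
open import Data.Empty using (⊥-elim)
open import Relation.Nullary using (¬_; Dec; yes; no)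
open import Relation.Binary.PropositionalEquality using (_≡_; refl; sym; trans; cong; cong₂; subst; module ≡-Reasoning)
open import Data.List.Membership.Propositional using (_∈_; find; lose)
open import Data.List.Membership.Propositional.Properties using (∈-concatMap⁻)
open import Data.List.Relation.Binary.Subset.Propositional using (_⊆_)
open import Data.List.Relation.Binary.Subset.Propositional.Properties
  using (⊆-refl; ⊆-trans; xs⊆xs++ys; ++⁺ˡ; Any-resp-⊆)
open import Data.List.Relation.Binary.Subset.DecPropositional _≟ₗ_ using (_⊆?_)
open import Data.List.Relation.Unary.Any using (Any; here; there; any?)

length-concatMap-≤ : ∀ {A B : Set} (f : A → List B) {n} → (∀ x → length (f x) ≤ n) →
  ∀ xs → length (concatMap f xs) ≤ n * length xs
length-concatMap-≤ f     bound []       = z≤n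
length-concatMap-≤ f {n} bound (x ∷ xs) = begin
  length (f x ++ concatMap f xs)         ≡⟨ length-++ (f x) ⟩
  length (f x) + length (concatMap f xs) ≤⟨ +-mono-≤ (bound x) (length-concatMap-≤ f bound xs) ⟩
  n + n * length xs                      ≡⟨ sym (*-suc n (length xs)) ⟩
  n * length (x ∷ xs)                    ∎
  where open ≤-Reasoning

≋-refl : ∀ {C} → C ≋ C
≋-refl = ⊆-refl , ⊆-refl

∈⇒InF : ∀ {F D} → D ∈ F → InF F D
∈⇒InF D∈F = lose D∈F ≋-refl

module _ (F : List Clause) where

  Subsumed : Clause → Set
  Subsumed C = Any (_⊆ C) F

  subsumed? : (C : Clause) → Dec (Subsumed C)
  subsumed? C = any? (_⊆? C) F

  leafFor : (C : Clause) → Dec (Subsumed C) → Tree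
  leafFor C (yes s) = weak C (leaf (proj₁ (find s)))
  leafFor C (no _)  = leaf C

  unsubsume : Tree → Tree
  unsubsume (leaf C)    = leafFor C (subsumed? C)
  unsubsume (weak C t)  = weak C (unsubsume t)
  unsubsume (res C l r) = res C (unsubsume l) (unsubsume r)

  nodesFor : Bool × Clause → List (Bool × Clause)
  nodesFor (true  , C) = postorder (leafFor C (subsumed? C))
  nodesFor (false , C) = [ (false , C) ]

  label-unsubsume : ∀ T → label (unsubsume T) ≡ label T
  label-unsubsume (leaf C) with subsumed? C
  ... | yes _ = refl
  ... | no _  = refl
  label-unsubsume (weak C t)  = refl
  label-unsubsume (res C l r) = refl

  postorder-unsubsume : ∀ T → postorder (unsubsume T) ≡ concatMap nodesFor (postorder T)
  postorder-unsubsume (leaf C) = sym (++-identityʳ (nodesFor (true , C)))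
  postorder-unsubsume (weak C t) = begin
    postorder (unsubsume t) ++ [ (false , C) ]          ≡⟨ cong (_++ [ (false , C) ]) (postorder-unsubsume t) ⟩
    concatMap nodesFor (postorder t) ++ [ (false , C) ] ≡⟨ sym (concatMap-++ nodesFor (postorder t) _) ⟩
    concatMap nodesFor (postorder t ++ [ (false , C) ]) ∎
    where open ≡-Reasoning
  postorder-unsubsume (res C l r) = begin
    postorder (unsubsume l) ++ postorder (unsubsume r) ++ [ (false , C) ]
      ≡⟨ cong₂ _++_ (postorder-unsubsume l) (cong (_++ [ (false , C) ]) (postorder-unsubsume r)) ⟩
    concatMap nodesFor (postorder l) ++ concatMap nodesFor (postorder r) ++ [ (false , C) ]
      ≡⟨ cong (concatMap nodesFor (postorder l) ++_) (sym (concatMap-++ nodesFor (postorder r) _)) ⟩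
    concatMap nodesFor (postorder l) ++ concatMap nodesFor (postorder r ++ [ (false , C) ])
      ≡⟨ sym (concatMap-++ nodesFor (postorder l) _) ⟩
    concatMap nodesFor (postorder l ++ postorder r ++ [ (false , C) ]) ∎
    where open ≡-Reasoning

  size-unsubsume : ∀ T → size (unsubsume T) ≤ 2 * size T
  size-unsubsume T = ≤-trans (≤-reflexive (cong length (postorder-unsubsume T)))
                             (length-concatMap-≤ nodesFor length-nodesFor (postorder T))
    where
    length-nodesFor : ∀ n → length (nodesFor n) ≤ 2
    length-nodesFor (true , C) with subsumed? C
    ... | yes _ = s≤s (s≤s z≤n)
    ... | no _  = s≤s z≤n
    length-nodesFor (false , C) = s≤s z≤n

  local-unsubsume : ∀ T → Local T → Local (unsubsume T)
  local-unsubsume (leaf C) _ with subsumed? C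
  ... | yes s = proj₂ (proj₂ (find s)) , tt
  ... | no _  = tt
  local-unsubsume (weak C t) (t⊆C , lt) rewrite label-unsubsume t =
    t⊆C , local-unsubsume t lt
  local-unsubsume (res C l r) (resolvent , ll , lr) rewrite label-unsubsume l | label-unsubsume r =
    resolvent , local-unsubsume l ll , local-unsubsume r lr

  leavesOK-unsubsume : ∀ ns {prev prev′} → prev ⊆ prev′ →
    LeavesOK F prev ns → LeavesOK F prev′ (concatMap nodesFor ns)
  leavesOK-unsubsume [] _ _ = tt
  leavesOK-unsubsume ((false , C) ∷ ns) prev⊆ ok = leavesOK-unsubsume ns (++⁺ˡ [ C ] prev⊆) ok
  leavesOK-unsubsume ((true , C) ∷ ns) {prev′ = prev′} prev⊆ (justified , ok) with subsumed? C
  ... | yes s = inj₁ (∈⇒InF (proj₁ (proj₂ (find s)))) ,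
      leavesOK-unsubsume ns (++⁺ˡ [ C ] (⊆-trans prev⊆ (xs⊆xs++ys prev′ _))) ok
  ... | no _  = Sum.map₂ (Any-resp-⊆ prev⊆) justified , leavesOK-unsubsume ns (++⁺ˡ [ C ] prev⊆) ok

  leaf-nodesFor : ∀ n C → (true , C) ∈ nodesFor n → C ∈ F ⊎ (n ≡ (true , C) × ¬ Subsumed C)
  leaf-nodesFor (true , E) C m with subsumed? E
  leaf-nodesFor (true , E) C (here refl)         | yes s = inj₁ (proj₁ (proj₂ (find s)))
  leaf-nodesFor (true , E) C (there (here ()))   | yes _
  leaf-nodesFor (true , E) C (here refl)         | no ¬s = inj₂ (refl , ¬s)
  leaf-nodesFor (false , E) C (here ())

  leaf-unsubsume : ∀ T C → (true , C) ∈ postorder (unsubsume T) →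
    C ∈ F ⊎ ((true , C) ∈ postorder T × ¬ Subsumed C)
  leaf-unsubsume T C m
    with n , n∈T , C∈n ← find (∈-concatMap⁻ nodesFor (subst ((true , C) ∈_) (postorder-unsubsume T) m))
    with leaf-nodesFor n C C∈n
  ... | inj₁ C∈F          = inj₁ C∈F
  ... | inj₂ (refl , ¬s)  = inj₂ (n∈T , ¬s)

lemma8p3 : (k : ℕ) (F : List Clause) (T : Tree) → RTLWk k F T →
    ∃[ T′ ] (RTLWk k F T′ × size T′ ≤ 2 * size T × NoSubsumedLemma F T′)
lemma8p3 k F T ((local , leavesOK , root) , small) =
  unsubsume F T ,
  ((local-unsubsume F T local ,
    subst (LeavesOK F []) (sym (postorder-unsubsume F T))
      (leavesOK-unsubsume F (postorder T) ⊆-refl leavesOK) ,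
    trans (label-unsubsume F T) root) ,
   λ C m ∉F → small C (proj₁ (oldLemma C m ∉F)) ∉F) ,
  size-unsubsume F T ,
  λ C m ∉F → proj₂ (oldLemma C m ∉F)
  where
  oldLemma : ∀ C → (true , C) ∈ postorder (unsubsume F T) → ¬ InF F C →
    (true , C) ∈ postorder T × ¬ Subsumed F C
  oldLemma C m ∉F with leaf-unsubsume F T C m
  ... | inj₁ C∈F = ⊥-elim (∉F (∈⇒InF C∈F))
  ... | inj₂ old = old
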